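{- For every positive integer $n$, with home state the fully horizontal state, the lattice of states of $SR_n$ is isomorphic to the poset on the spread-out subsets of $[n]$ in which $A\le B$ if and only if $w(A)\ge w(B)$ coordinatewise.
   Context: The robotic arm $SR_n$: $n$ unit links in the strip $[0,n]\times[0,1]$, base at $(0,0)$, each facing north, south or east, never revisiting a point; a state is labelled by the set $A$ of indices of vertical links, and these are exactly the spread-out subsets of $[n]$ (no two consecutive integers). Moves: two consecutive links facing different directions interchange directions, provided the result is valid; the last link rotates $90^\circ$ between horizontal and vertical, provided the result is valid. The transition graph has states as vertices and edges between states differing by one move. With home state $u$ the fully horizontal state, the poset of states is given by $p\le q$ iff some shortest edge-path from $u$ to $q$ in the transition graph passes through $p$. For $A=\{a_1<\cdots<a_k\}\subseteq[n]$, $w(A)$ is the length-$n$ vector $(a_1,\dots,a_k,n+1,\dots,n+1)$. -}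

module Defs where

open import Data.Nat using (ℕ; zero; suc; _+_; _∸_; _≤_; _≥_)
open import Data.Product using (Σ; _×_; _,_; proj₁)
open import Data.List using (List; []; _∷_; _++_; length; replicate)
open import Data.Maybe using (Maybe; just; nothing)
open import Data.List.Relation.Unary.Unique.Propositional using (Unique)
open import Data.List.Relation.Binary.Pointwise using (Pointwise)
open import Relation.Binary.PropositionalEquality using (_≡_; _≢_)

data Dir : Set where
  N S E : Dir

-- points of the strip [0,n]×[0,1] (x-coordinate, y-coordinate);
-- the y-coordinate is 0 or 1, encoded as a natural number
Point : Set
Point = ℕ × ℕ

-- one unit step in direction d; 'nothing' if it leaves the strip
-- vertically (x never exceeds the number of links, so the constraint
-- x ≤ n is automatic for configurations of length n)
step : Point → Dir → Maybe Point
step (x , zero)           N = just (x , 1)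
step (x , suc zero)       N = nothing
step (x , suc (suc y))    N = nothing
step (x , zero)           S = nothing
step (x , suc zero)       S = just (x , 0)
step (x , suc (suc y))    S = nothing
step (x , y)              E = just (suc x , y)

trace : Point → List Dir → Maybe (List Point)
trace p [] = just (p ∷ [])
trace p (d ∷ ds) with step p d
... | nothing = nothing
... | just q with trace q ds
...   | nothing = nothing
...   | just qs = just (p ∷ qs)

Valid : List Dir → Set
Valid ds = Σ (List Point) λ ps → (trace (0 , 0) ds ≡ just ps) × Unique ps

State : ℕ → Set
State n = Σ (List Dir) λ ds → (length ds ≡ n) × Valid ds

cfg : ∀ {n} → State n → List Dir
cfg = proj₁

data Swap : List Dir → List Dir → Set where
  here  : ∀ {d e ds} → d ≢ e → Swap (d ∷ e ∷ ds) (e ∷ d ∷ ds)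
  there : ∀ {d ds es} → Swap ds es → Swap (d ∷ ds) (d ∷ es)

data Rot90 : Dir → Dir → Set where
  EN : Rot90 E N
  NE : Rot90 N E
  ES : Rot90 E S
  SE : Rot90 S E

data RotLast : List Dir → List Dir → Set where
  last  : ∀ {d e} → Rot90 d e → RotLast (d ∷ []) (e ∷ [])
  there : ∀ {d ds es} → RotLast ds es → RotLast (d ∷ ds) (d ∷ es)

data Move : List Dir → List Dir → Set where
  swap : ∀ {ds es} → Swap ds es → Move ds es
  rot  : ∀ {ds es} → RotLast ds es → Move ds es

data Walk : List Dir → List Dir → ℕ → Set where
  nil  : ∀ {x} → Walk x x 0
  cons : ∀ {x y z k} → Move x y → Valid y → Walk y z k → Walk x z (suc k)

home : ℕ → List Dir
home n = replicate n E

-- p ≤ q iff some shortest edge-path from home to q passes through p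
_≤ₛ_ : ∀ {n} → State n → State n → Set
_≤ₛ_ {n} p q =
  Σ ℕ λ k → Σ ℕ λ m →
    Walk (home n) (cfg p) k × Walk (cfg p) (cfg q) m ×
    (∀ l → Walk (home n) (cfg q) l → k + m ≤ l)

-- Spread-out subsets of [n] = {1,…,n}, as strictly increasing lists

data SpreadFrom (n : ℕ) : ℕ → List ℕ → Set where
  []  : ∀ {m} → SpreadFrom n m []
  _∷_ : ∀ {m a as} → (m ≤ a × a ≤ n) → SpreadFrom n (2 + a) as →
        SpreadFrom n m (a ∷ as)

SpreadOut : ℕ → Set
SpreadOut n = Σ (List ℕ) (SpreadFrom n 1)

elems : ∀ {n} → SpreadOut n → List ℕ
elems = proj₁

w : ℕ → List ℕ → List ℕ
w n A = A ++ replicate (n ∸ length A) (suc n)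

_≤w_ : ∀ {n} → SpreadOut n → SpreadOut n → Set
_≤w_ {n} A B = Pointwise _≥_ (w n (elems A)) (w n (elems B))

-- A state is determined by its set of vertical links: their directions are forced
-- (N from the bottom row, S from the top row), and the only constraint is that no two
-- of them are adjacent, i.e. the set is spread out.
--
-- The profile of a state lists, for i = 1, …, n, the number of vertical links among
-- the first i links. A move changes the profile in at most one entry, by at most one,
-- so a walk is at least as long as the ℓ¹-distance of the profiles of its ends.
-- Conversely, if the profile of p is below that of q entrywise, some move from p raises
-- its profile in one entry without leaving the region below q; hence such p and q are
-- joined by a walk of length equal to that distance, and the distance from home to q is
-- the sum of q's profile. So p lies on a shortest walk from home to q exactly when
-- sum p + dist p q = sum q, i.e. when profile p ≤ profile q entrywise. In terms of the
-- sets A and B of vertical links this says that the j-th element of B is at most the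
-- j-th element of A for every j, which is w(A) ≥ w(B).

module Submission where

open import Data.Bool using (Bool; true; false; not)
open import Data.Empty using (⊥-elim)
open import Data.List using (List; []; _∷_; _++_; length; replicate; map; drop)
open import Data.List.Properties using (drop-[]; length-map)
open import Data.List.Relation.Binary.Pointwise as Pointwise using (Pointwise; []; _∷_)
open import Data.List.Relation.Unary.All as All using (All; []; _∷_)
open import Data.List.Relation.Unary.AllPairs using ([]; _∷_)
open import Data.List.Relation.Unary.Unique.Propositional using (Unique)
open import Data.Maybe using (just)
open import Data.Nat using (ℕ; zero; suc; _+_; _∸_; ∣_-_∣; _≤_; _<_; _≥_; z≤n; s≤s; _≟_)
open import Data.Nat.ListAction using (sum)
open import Data.Nat.Properties
open import Algebra.Properties.CommutativeSemigroup +-commutativeSemigroup using (interchange)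
open import Data.Product using (Σ; _×_; _,_; proj₁; proj₂)
open import Data.Sum using (_⊎_; inj₁; inj₂)
open import Function using (_∘_)
open import Relation.Binary.PropositionalEquality
open import Relation.Nullary using (¬_; yes; no; contradiction)

open import Defs

-- Arm t v ds: ds is valid when started in the top row (t = true) or the bottom row,
-- right after a vertical link (v = true) or not.
data Arm : Bool → Bool → List Dir → Set where
  []  : ∀ {t v} → Arm t v []
  E∷_ : ∀ {t v ds} → Arm t false ds → Arm t v (E ∷ ds)
  N∷_ : ∀ {ds} → Arm true true ds → Arm false false (N ∷ ds)
  S∷_ : ∀ {ds} → Arm false true ds → Arm true false (S ∷ ds)

height : Bool → ℕ
height false = 0
height true  = 1

step-E : ∀ x t → step (x , height t) E ≡ just (suc x , height t)
step-E x false = refl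
step-E x true  = refl

trace-∷ : ∀ {p q} d ds {qs} → step p d ≡ just q → trace q ds ≡ just qs →
          trace p (d ∷ ds) ≡ just (p ∷ qs)
trace-∷ d ds s t rewrite s | t = refl

trace-∷⁻ : ∀ p d ds {ps} → trace p (d ∷ ds) ≡ just ps →
           Σ Point λ q → step p d ≡ just q ×
           Σ (List Point) λ qs → trace q ds ≡ just qs × ps ≡ p ∷ qs
trace-∷⁻ p d ds eq with step p d in s
... | just q with trace q ds in t
... | just qs with refl ← eq = q , refl , qs , t , refl

trace-head : ∀ {p} ds {ps} → trace p ds ≡ just ps → Σ (List Point) λ qs → ps ≡ p ∷ qs
trace-head []       refl = _ , refl
trace-head (d ∷ ds) eq with trace-∷⁻ _ d ds eq
... | _ , _ , qs , _ , e = qs , e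

left-fresh : ∀ {x h} {qs : List Point} → All (λ q → x < proj₁ q) qs → All ((x , h) ≢_) qs
left-fresh []            = []
left-fresh (x<q ∷ x<qs) = (λ eq → <-irrefl (cong proj₁ eq) x<q) ∷ left-fresh x<qs

-- After a vertical link the arm must move east, so every later point lies
-- strictly to the right of the current column.
arm-trace : ∀ {t v ds} → Arm t v ds → ∀ x → Σ (List Point) λ ps →
            trace (x , height t) ds ≡ just ((x , height t) ∷ ps) ×
            Unique ((x , height t) ∷ ps) ×
            All (λ q → x ≤ proj₁ q) ps × (v ≡ true → All (λ q → x < proj₁ q) ps)
arm-trace [] x = [] , refl , [] ∷ [] , [] , λ _ → []
arm-trace {t} {ds = E ∷ ds} (E∷ a) x with arm-trace a (suc x)
... | ps , tr , u , x<ps , _ =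
  (suc x , height t) ∷ ps , trace-∷ E ds (step-E x t) tr ,
  left-fresh right ∷ u , All.map <⇒≤ right , λ _ → right
  where
  right : All (λ q → x < proj₁ q) ((suc x , height t) ∷ ps)
  right = ≤-refl ∷ x<ps
arm-trace {ds = N ∷ ds} (N∷ a) x with arm-trace a x
... | ps , tr , u , x≤ps , x<ps =
  (x , 1) ∷ ps , trace-∷ N ds refl tr , ((λ ()) ∷ left-fresh (x<ps refl)) ∷ u , ≤-refl ∷ x≤ps , λ ()
arm-trace {ds = S ∷ ds} (S∷ a) x with arm-trace a x
... | ps , tr , u , x≤ps , x<ps =
  (x , 0) ∷ ps , trace-∷ S ds refl tr , ((λ ()) ∷ left-fresh (x<ps refl)) ∷ u , ≤-refl ∷ x≤ps , λ ()

arm⇒valid : ∀ {ds} → Arm false false ds → Valid ds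
arm⇒valid a with arm-trace a 0
... | _ , tr , u , _ = _ , tr , u

-- the point just left, already visited when the previous link was vertical
behind : Bool → ℕ → Bool → List Point
behind false x t = []
behind true  x t = (x , height (not t)) ∷ []

trace⇒arm : ∀ t v x ds {ps} → trace (x , height t) ds ≡ just ps →
            Unique (behind v x t ++ ps) → Arm t v ds
trace⇒arm t v x [] tr u = []
trace⇒arm t v x (E ∷ ds) tr u with trace-∷⁻ (x , height t) E ds tr
... | q , s , qs , tr′ , refl with trans (sym s) (step-E x t)
... | refl = E∷ trace⇒arm t false (suc x) ds tr′ (tail v u)
  where
  tail : ∀ v → Unique (behind v x t ++ (x , height t) ∷ qs) → Unique qs
  tail false (_ ∷ u) = u
  tail true  (_ ∷ _ ∷ u) = u
trace⇒arm false v x (N ∷ ds) tr u with trace-∷⁻ (x , 0) N ds tr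
... | _ , refl , qs , tr′ , refl with v | trace-head ds tr′
... | false | _ = N∷ trace⇒arm true true x ds tr′ u
... | true  | _ , refl with u
...   | (_ ∷ revisit ∷ _) ∷ _ = ⊥-elim (revisit refl)
trace⇒arm true v x (N ∷ ds) tr u with trace-∷⁻ (x , 1) N ds tr
... | _ , () , _
trace⇒arm true v x (S ∷ ds) tr u with trace-∷⁻ (x , 1) S ds tr
... | _ , refl , qs , tr′ , refl with v | trace-head ds tr′
... | false | _ = S∷ trace⇒arm false true x ds tr′ u
... | true  | _ , refl with u
...   | (_ ∷ revisit ∷ _) ∷ _ = ⊥-elim (revisit refl)
trace⇒arm false v x (S ∷ ds) tr u with trace-∷⁻ (x , 0) S ds tr
... | _ , () , _

valid⇒arm : ∀ {ds} → Valid ds → Arm false false ds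
valid⇒arm (_ , tr , u) = trace⇒arm false false 0 _ tr u

home-arm : ∀ n → Arm false false (home n)
home-arm zero    = []
home-arm (suc n) = E∷ home-arm n

vertical : Dir → Bool
vertical E = false
vertical N = true
vertical S = true

verticals : List Dir → List Bool
verticals = map vertical

inc : Bool → ℕ → ℕ
inc false k = k
inc true  k = suc k

inc-≥ : ∀ v k → k ≤ inc v k
inc-≥ false k = ≤-refl
inc-≥ true  k = n≤1+n k

inc-≤-suc : ∀ v k → inc v k ≤ suc k
inc-≤-suc false k = n≤1+n k
inc-≤-suc true  k = ≤-refl

positions : ℕ → List Bool → List ℕ
positions k []           = []
positions k (false ∷ us) = positions (suc k) us
positions k (true  ∷ us) = k ∷ positions (suc k) us

orient : Bool → List Bool → List Dir
orient t     []           = []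
orient t     (false ∷ us) = E ∷ orient t us
orient false (true  ∷ us) = N ∷ orient true us
orient true  (true  ∷ us) = S ∷ orient false us

-- entries k, …, k+r-1 of the characteristic vector of A, correct only for increasing A
indicator : ℕ → ℕ → List ℕ → List Bool
indicator k zero    A       = []
indicator k (suc r) []      = false ∷ indicator (suc k) r []
indicator k (suc r) (a ∷ A) with k ≟ a
... | yes _ = true  ∷ indicator (suc k) r A
... | no  _ = false ∷ indicator (suc k) r (a ∷ A)

length-orient : ∀ t us → length (orient t us) ≡ length us
length-orient t     []           = refl
length-orient t     (false ∷ us) = cong suc (length-orient t us)
length-orient false (true  ∷ us) = cong suc (length-orient true us)
length-orient true  (true  ∷ us) = cong suc (length-orient false us)

length-indicator : ∀ k r A → length (indicator k r A) ≡ r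
length-indicator k zero    A       = refl
length-indicator k (suc r) []      = cong suc (length-indicator (suc k) r [])
length-indicator k (suc r) (a ∷ A) with k ≟ a
... | yes _ = cong suc (length-indicator (suc k) r A)
... | no  _ = cong suc (length-indicator (suc k) r (a ∷ A))

verticals-orient : ∀ t us → verticals (orient t us) ≡ us
verticals-orient t     []           = refl
verticals-orient t     (false ∷ us) = cong (false ∷_) (verticals-orient t us)
verticals-orient false (true  ∷ us) = cong (true ∷_) (verticals-orient true us)
verticals-orient true  (true  ∷ us) = cong (true ∷_) (verticals-orient false us)

orient-verticals : ∀ {t v ds} → Arm t v ds → orient t (verticals ds) ≡ ds
orient-verticals []     = refl
orient-verticals (E∷ a) = cong (E ∷_) (orient-verticals a)
orient-verticals (N∷ a) = cong (N ∷_) (orient-verticals a)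
orient-verticals (S∷ a) = cong (S ∷_) (orient-verticals a)

positions-≥ : ∀ k us → All (k ≤_) (positions k us)
positions-≥ k []           = []
positions-≥ k (false ∷ us) = All.map (≤-trans (n≤1+n k)) (positions-≥ (suc k) us)
positions-≥ k (true  ∷ us) = ≤-refl ∷ All.map (≤-trans (n≤1+n k)) (positions-≥ (suc k) us)

length-positions : ∀ k us → length (positions k us) ≤ length us
length-positions k []           = z≤n
length-positions k (false ∷ us) = m≤n⇒m≤1+n (length-positions (suc k) us)
length-positions k (true  ∷ us) = s≤s (length-positions (suc k) us)

indicator-hit : ∀ k r A → indicator k (suc r) (k ∷ A) ≡ true ∷ indicator (suc k) r A
indicator-hit k r A with k ≟ k
... | yes _  = refl
... | no k≢k = contradiction refl k≢k

indicator-miss : ∀ k r A → All (k <_) A → indicator k (suc r) A ≡ false ∷ indicator (suc k) r A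
indicator-miss k r []      _         = refl
indicator-miss k r (a ∷ A) (k<a ∷ _) with k ≟ a
... | yes refl = contradiction k<a (n≮n k)
... | no  _    = refl

indicator-positions : ∀ k us → indicator k (length us) (positions k us) ≡ us
indicator-positions k [] = refl
indicator-positions k (false ∷ us) = begin
  indicator k (suc (length us)) (positions (suc k) us)
    ≡⟨ indicator-miss k _ _ (positions-≥ (suc k) us) ⟩
  false ∷ indicator (suc k) (length us) (positions (suc k) us)
    ≡⟨ cong (false ∷_) (indicator-positions (suc k) us) ⟩
  false ∷ us ∎
  where open ≡-Reasoning
indicator-positions k (true ∷ us) = begin
  indicator k (suc (length us)) (k ∷ positions (suc k) us)
    ≡⟨ indicator-hit k _ _ ⟩
  true ∷ indicator (suc k) (length us) (positions (suc k) us)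
    ≡⟨ cong (true ∷_) (indicator-positions (suc k) us) ⟩
  true ∷ us ∎
  where open ≡-Reasoning

shift-suc : ∀ k r {n} → k + suc r ≡ n → suc k + r ≡ n
shift-suc k r e = trans (sym (+-suc k r)) e

+-suc≡suc⇒≤ : ∀ k r {n} → k + suc r ≡ suc n → k ≤ n
+-suc≡suc⇒≤ k r e = subst (k ≤_) (suc-injective (shift-suc k r e)) (m≤m+n k r)

spreadFrom-weaken : ∀ {n m m′ A} → m′ ≤ m → SpreadFrom n m A → SpreadFrom n m′ A
spreadFrom-weaken m′≤m []                 = []
spreadFrom-weaken m′≤m ((m≤a , a≤n) ∷ sp) = (≤-trans m′≤m m≤a , a≤n) ∷ sp

positions-indicator : ∀ n k r A → k + r ≡ suc n → SpreadFrom n k A → positions k (indicator k r A) ≡ A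
positions-indicator n k zero    []      e sp = refl
positions-indicator n k zero    (a ∷ A) e ((k≤a , a≤n) ∷ _) =
  ⊥-elim (n≮n n (subst (_≤ n) (trans (sym (+-identityʳ k)) e) (≤-trans k≤a a≤n)))
positions-indicator n k (suc r) [] e sp = positions-indicator n (suc k) r [] (shift-suc k r e) []
positions-indicator n k (suc r) (a ∷ A) e ((k≤a , a≤n) ∷ sp) with k ≟ a
... | yes refl = cong (k ∷_) (positions-indicator n (suc k) r A (shift-suc k r e) (spreadFrom-weaken (n≤1+n _) sp))
... | no  k≢a  = positions-indicator n (suc k) r (a ∷ A) (shift-suc k r e) ((≤∧≢⇒< k≤a k≢a , a≤n) ∷ sp)

positions-spreadFrom : ∀ {t v ds} n k → Arm t v ds → k + length ds ≡ suc n →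
                       SpreadFrom n (inc v k) (positions k (verticals ds))
positions-spreadFrom n k [] e = []
positions-spreadFrom {v = v} n k (E∷ a) e =
  spreadFrom-weaken (inc-≤-suc v k) (positions-spreadFrom n (suc k) a (shift-suc k _ e))
positions-spreadFrom n k (N∷ a) e =
  (≤-refl , +-suc≡suc⇒≤ k _ e) ∷ positions-spreadFrom n (suc k) a (shift-suc k _ e)
positions-spreadFrom n k (S∷ a) e =
  (≤-refl , +-suc≡suc⇒≤ k _ e) ∷ positions-spreadFrom n (suc k) a (shift-suc k _ e)

orient-indicator-arm : ∀ {n} t v k r A → SpreadFrom n (inc v k) A → Arm t v (orient t (indicator k r A))
orient-indicator-arm t v k zero    A  sp = []
orient-indicator-arm {n} t v k (suc r) [] sp = E∷ orient-indicator-arm {n} t false (suc k) r [] []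
orient-indicator-arm t v k (suc r) (a ∷ A) ((k≤a , a≤n) ∷ sp) with k ≟ a
orient-indicator-arm t     v     k (suc r) (a ∷ A) ((k≤a , a≤n) ∷ sp) | no k≢a =
  E∷ orient-indicator-arm t false (suc k) r (a ∷ A) ((≤∧≢⇒< (≤-trans (inc-≥ v k) k≤a) k≢a , a≤n) ∷ sp)
orient-indicator-arm t     true  k (suc r) (k ∷ A) ((k<k , _) ∷ sp)   | yes refl = ⊥-elim (n≮n k k<k)
orient-indicator-arm false false k (suc r) (k ∷ A) (_ ∷ sp)           | yes refl =
  N∷ orient-indicator-arm true true (suc k) r A sp
orient-indicator-arm true  false k (suc r) (k ∷ A) (_ ∷ sp)           | yes refl =
  S∷ orient-indicator-arm false true (suc k) r A sp

counts : ℕ → List Bool → List ℕ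
counts c []       = []
counts c (u ∷ us) = inc u c ∷ counts (inc u c) us

profile : List Dir → List ℕ
profile ds = counts 0 (verticals ds)

length-counts : ∀ c us → length (counts c us) ≡ length us
length-counts c []       = refl
length-counts c (u ∷ us) = cong suc (length-counts (inc u c) us)

profile-home : ∀ n → profile (home n) ≡ replicate n 0
profile-home zero    = refl
profile-home (suc n) = cong (0 ∷_) (profile-home n)

sum-profile-home : ∀ n → sum (profile (home n)) ≡ 0
sum-profile-home zero    = refl
sum-profile-home (suc n) = sum-profile-home n

dist : List ℕ → List ℕ → ℕ
dist (x ∷ xs) (y ∷ ys) = ∣ x - y ∣ + dist xs ys
dist _        _        = 0

dist-self : ∀ xs → dist xs xs ≡ 0
dist-self []       = refl
dist-self (x ∷ xs) = cong₂ _+_ (∣n-n∣≡0 x) (dist-self xs)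

dist-zeros : ∀ ys → dist (replicate (length ys) 0) ys ≡ sum ys
dist-zeros []       = refl
dist-zeros (y ∷ ys) = cong (y +_) (dist-zeros ys)

data Near : List ℕ → List ℕ → Set where
  here  : ∀ {x y zs} → ∣ x - y ∣ ≤ 1 → Near (x ∷ zs) (y ∷ zs)
  there : ∀ {z xs ys} → Near xs ys → Near (z ∷ xs) (z ∷ ys)

near-dist : ∀ {xs ys} → Near xs ys → ∀ zs → dist xs zs ≤ suc (dist ys zs)
near-dist (here _)  []       = z≤n
near-dist (there _) []       = z≤n
near-dist {x ∷ _} {y ∷ _} (here ∣x-y∣≤1) (z ∷ zs) =
  +-monoˡ-≤ _ (≤-trans (∣-∣-triangle x y z) (+-monoˡ-≤ _ ∣x-y∣≤1))
near-dist {z ∷ xs} (there near) (z′ ∷ zs) =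
  subst (∣ z - z′ ∣ + dist xs zs ≤_) (+-suc ∣ z - z′ ∣ _) (+-monoʳ-≤ ∣ z - z′ ∣ (near-dist near zs))

∣n-1+n∣≡1 : ∀ n → ∣ n - suc n ∣ ≡ 1
∣n-1+n∣≡1 zero    = refl
∣n-1+n∣≡1 (suc n) = ∣n-1+n∣≡1 n

inc-near : ∀ u v c → ∣ inc u c - inc v c ∣ ≤ 1
inc-near false false c = ≤-trans (≤-reflexive (∣n-n∣≡0 c)) z≤n
inc-near true  true  c = ≤-trans (≤-reflexive (∣n-n∣≡0 c)) z≤n
inc-near false true  c = ≤-reflexive (∣n-1+n∣≡1 c)
inc-near true  false c = ≤-reflexive (trans (∣-∣-comm (suc c) c) (∣n-1+n∣≡1 c))

inc-comm : ∀ u v c → inc v (inc u c) ≡ inc u (inc v c)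
inc-comm false false c = refl
inc-comm false true  c = refl
inc-comm true  false c = refl
inc-comm true  true  c = refl

swap-near : ∀ {xs ys} → Swap xs ys → ∀ c → Near (counts c (verticals xs)) (counts c (verticals ys))
swap-near (here {d} {e} _) c rewrite inc-comm (vertical d) (vertical e) c =
  here (inc-near (vertical d) (vertical e) c)
swap-near (there {d} sw)        c = there (swap-near sw (inc (vertical d) c))

rotLast-near : ∀ {xs ys} → RotLast xs ys → ∀ c → Near (counts c (verticals xs)) (counts c (verticals ys))
rotLast-near (last {d} {e} _) c = here (inc-near (vertical d) (vertical e) c)
rotLast-near (there {d} rl)   c = there (rotLast-near rl (inc (vertical d) c))

move-near : ∀ {xs ys} → Move xs ys → Near (profile xs) (profile ys)
move-near (swap sw) = swap-near sw 0
move-near (rot rl)  = rotLast-near rl 0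

walk-dist : ∀ {xs ys k} → Walk xs ys k → ∀ zs → dist (profile xs) zs ≤ k + dist (profile ys) zs
walk-dist nil             zs = ≤-refl
walk-dist (cons mv _ wk) zs = ≤-trans (near-dist (move-near mv) zs) (s≤s (walk-dist wk zs))

walk-length : ∀ {xs ys k} → Walk xs ys k → dist (profile xs) (profile ys) ≤ k
walk-length {ys = ys} {k} wk =
  subst (_ ≤_) (trans (cong (k +_) (dist-self (profile ys))) (+-identityʳ k)) (walk-dist wk (profile ys))

sum-mono : ∀ {xs ys} → Pointwise _≤_ xs ys → sum xs ≤ sum ys
sum-mono []            = z≤n
sum-mono (x≤y ∷ xs≤ys) = +-mono-≤ x≤y (sum-mono xs≤ys)

zeros-≤ : ∀ ys → Pointwise _≤_ (replicate (length ys) 0) ys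
zeros-≤ []       = []
zeros-≤ (y ∷ ys) = z≤n ∷ zeros-≤ ys

+-≤-components : ∀ {a b c d} → c ≤ a → d ≤ b → a + b ≤ c + d → a ≤ c × b ≤ d
+-≤-components {a} {b} {c} {d} c≤a d≤b ab≤cd =
  +-cancelʳ-≤ b a c (≤-trans ab≤cd (+-monoʳ-≤ c d≤b)) ,
  +-cancelˡ-≤ a b d (≤-trans ab≤cd (+-monoˡ-≤ d c≤a))

sum≤sum+dist : ∀ xs ys → length xs ≡ length ys → sum ys ≤ sum xs + dist xs ys
sum≤sum+dist []       []       _ = z≤n
sum≤sum+dist (x ∷ xs) (y ∷ ys) e =
  subst (y + sum ys ≤_) (interchange x ∣ x - y ∣ (sum xs) (dist xs ys))
    (+-mono-≤ (m≤n+∣n-m∣ y x) (sum≤sum+dist xs ys (suc-injective e)))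

geodesic⇒≤ : ∀ xs ys → length xs ≡ length ys → sum xs + dist xs ys ≤ sum ys → Pointwise _≤_ xs ys
geodesic⇒≤ []       []       _ _ = []
geodesic⇒≤ (x ∷ xs) (y ∷ ys) e h
  with +-≤-components (m≤n+∣n-m∣ y x) (sum≤sum+dist xs ys (suc-injective e))
         (subst (_≤ y + sum ys) (interchange x (sum xs) ∣ x - y ∣ (dist xs ys)) h)
... | x+∣x-y∣≤y , rest = ≤-trans (m≤m+n x _) x+∣x-y∣≤y ∷ geodesic⇒≤ xs ys (suc-injective e) rest

arm-relax : ∀ {t ds} → Arm t true ds → Arm t false ds
arm-relax []     = []
arm-relax (E∷ a) = E∷ a

move-∷ : ∀ {d xs ys} → Move xs ys → Move (d ∷ xs) (d ∷ ys)
move-∷ (swap sw) = swap (there sw)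
move-∷ (rot rl)  = rot (there rl)

Approach : Bool → Bool → ℕ → List Dir → List Dir → Set
Approach t v c p q = Σ (List Dir) λ p′ → Move p p′ × Arm t v p′ ×
  Pointwise _≤_ (counts c (verticals p′)) (counts c (verticals q)) ×
  sum (counts c (verticals p′)) ≡ suc (sum (counts c (verticals p)))

-- An east link whose count lies strictly below the target: bring the next vertical
-- link back across it (or turn the last link if there is none).
pull : ∀ {t} c d r ws → Arm t false r → c < d → Pointwise _≤_ (counts c (verticals r)) (counts d ws) →
       Σ (List Dir) λ r′ → Move (E ∷ r) r′ × Arm t false r′ ×
         Pointwise _≤_ (counts c (verticals r′)) (d ∷ counts d ws) ×
         sum (counts c (verticals r′)) ≡ suc (sum (counts c (verticals (E ∷ r))))
pull {false} c d []      []       []     c<d [] = N ∷ [] , rot (last EN) , N∷ [] , c<d ∷ [] , refl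
pull {true}  c d []      []       []     c<d [] = S ∷ [] , rot (last ES) , S∷ [] , c<d ∷ [] , refl
pull         c d (E ∷ r) (w ∷ ws) (E∷ a) c<d (_ ∷ pw)
  with pull c (inc w d) r ws a (<-≤-trans c<d (inc-≥ w d)) pw
... | r′ , mv , a′ , pw′ , e =
  E ∷ r′ , move-∷ mv , E∷ a′ , <⇒≤ c<d ∷ pw′ , trans (cong (c +_) e) (+-suc c _)
pull         c d (N ∷ r) ws       (N∷ a) c<d pw =
  N ∷ E ∷ r , swap (here λ ()) , N∷ E∷ arm-relax a , c<d ∷ pw , refl
pull         c d (S ∷ r) ws       (S∷ a) c<d pw =
  S ∷ E ∷ r , swap (here λ ()) , S∷ E∷ arm-relax a , c<d ∷ pw , refl

approach-∷ : ∀ {t v t′ v′ d c p q} → (∀ {r} → Arm t v r → Arm t′ v′ (d ∷ r)) →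
             p ≡ q ⊎ Approach t v (inc (vertical d) c) p q →
             d ∷ p ≡ d ∷ q ⊎ Approach t′ v′ c (d ∷ p) (d ∷ q)
approach-∷ arm (inj₁ refl) = inj₁ refl
approach-∷ {d = d} {c} arm (inj₂ (p′ , mv , a , pw , e)) =
  inj₂ (d ∷ p′ , move-∷ mv , arm a , ≤-refl ∷ pw , trans (cong (inc (vertical d) c +_) e) (+-suc _ _))

-- At the first link where p and q differ, p is east and q vertical.
climb : ∀ {t v} c p q → Arm t v p → Arm t v q → Pointwise _≤_ (counts c (verticals p)) (counts c (verticals q)) →
        p ≡ q ⊎ Approach t v c p q
climb c []      []      _       _       _        = inj₁ refl
climb c []      (_ ∷ _) _       _       ()
climb c (_ ∷ _) []      _       _       ()
climb c (E ∷ p) (E ∷ q) (E∷ ap) (E∷ aq) (_ ∷ pw) = approach-∷ E∷_ (climb c p q ap aq pw)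
climb c (N ∷ p) (N ∷ q) (N∷ ap) (N∷ aq) (_ ∷ pw) = approach-∷ N∷_ (climb (suc c) p q ap aq pw)
climb c (S ∷ p) (S ∷ q) (S∷ ap) (S∷ aq) (_ ∷ pw) = approach-∷ S∷_ (climb (suc c) p q ap aq pw)
climb c (N ∷ p) (E ∷ q) (N∷ _)  (E∷ _)  (c<c ∷ _) = ⊥-elim (n≮n c c<c)
climb c (S ∷ p) (E ∷ q) (S∷ _)  (E∷ _)  (c<c ∷ _) = ⊥-elim (n≮n c c<c)
climb c (E ∷ p) (N ∷ q) (E∷ ap) (N∷ _)  (_ ∷ pw) = inj₂ (pull c (suc c) p (verticals q) ap ≤-refl pw)
climb c (E ∷ p) (S ∷ q) (E∷ ap) (S∷ _)  (_ ∷ pw) = inj₂ (pull c (suc c) p (verticals q) ap ≤-refl pw)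

walk-up : ∀ m {p q} → Arm false false p → Arm false false q → Pointwise _≤_ (profile p) (profile q) →
        sum (profile p) + m ≡ sum (profile q) → Walk p q m
walk-up m       {p} {q} ap aq  p≤q e with climb 0 p q ap aq p≤q
walk-up zero    {p} {q} _  _   _   _ | inj₁ refl = nil
walk-up (suc m) {p} {q} _  _   _   e | inj₁ refl = ⊥-elim (m+1+n≢m (sum (profile p)) e)
walk-up zero    {p} {q} _  _   _   e | inj₂ (_ , _ , _ , p′≤q , e′) =
  ⊥-elim (n≮n (sum (profile p)) (subst₂ _≤_ e′ (trans (sym e) (+-identityʳ _)) (sum-mono p′≤q)))
walk-up (suc m) {p} {q} _  aq  _   e | inj₂ (p′ , mv , ap′ , p′≤q , e′) =
  cons mv (arm⇒valid ap′) (walk-up m ap′ aq p′≤q (trans (trans (cong (_+ m) e′) (sym (+-suc _ m))) e))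

-- A ⊒ B says w(A) ≥ w(B) entrywise, where missing entries count as larger than all others.
data _⊒_ : List ℕ → List ℕ → Set where
  []  : ∀ {B} → [] ⊒ B
  _∷_ : ∀ {a b A B} → b ≤ a → A ⊒ B → (a ∷ A) ⊒ (b ∷ B)

-- w n A = padded (suc n) n A
padded : ℕ → ℕ → List ℕ → List ℕ
padded t m A = A ++ replicate (m ∸ length A) t

⊒⇒padded-≥ : ∀ t m A B → A ⊒ B → All (_< t) B → length A ≤ m → length B ≤ m →
             Pointwise _≥_ (padded t m A) (padded t m B)
⊒⇒padded-≥ t m       []      []      []        _           _         _         = Pointwise.refl ≤-refl
⊒⇒padded-≥ t (suc m) []      (b ∷ B) []        (b<t ∷ B<t) _         (s≤s B≤m) =
  <⇒≤ b<t ∷ ⊒⇒padded-≥ t m [] B [] B<t z≤n B≤m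
⊒⇒padded-≥ t (suc m) (a ∷ A) (b ∷ B) (b≤a ∷ h) (_ ∷ B<t)   (s≤s A≤m) (s≤s B≤m) =
  b≤a ∷ ⊒⇒padded-≥ t m A B h B<t A≤m B≤m

padded-≥⇒⊒ : ∀ t m A B → Pointwise _≥_ (padded t m A) (padded t m B) → All (_< t) A → length A ≤ m → A ⊒ B
padded-≥⇒⊒ t m       []      B       _         _         _         = []
padded-≥⇒⊒ t (suc m) (a ∷ A) []      (t≤a ∷ _) (a<t ∷ _) _         = ⊥-elim (<-irrefl refl (<-≤-trans a<t t≤a))
padded-≥⇒⊒ t (suc m) (a ∷ A) (b ∷ B) (b≤a ∷ h) (_ ∷ A<t) (s≤s A≤m) = b≤a ∷ padded-≥⇒⊒ t m A B h A<t A≤m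

spreadFrom-< : ∀ {n m A} → SpreadFrom n m A → All (_< suc n) A
spreadFrom-< []              = []
spreadFrom-< ((_ , a≤n) ∷ sp) = s≤s a≤n ∷ spreadFrom-< sp

drop-⊒-∷ : ∀ {k} d A {B} → All (k <_) A → drop (suc d) A ⊒ B → drop d A ⊒ (k ∷ B)
drop-⊒-∷ zero    []      _           _ = []
drop-⊒-∷ zero    (a ∷ A) (k<a ∷ _)   h = <⇒≤ k<a ∷ h
drop-⊒-∷ (suc d) []      _           _ = []
drop-⊒-∷ (suc d) (a ∷ A) (_ ∷ k<A)  h = drop-⊒-∷ d A k<A h

drop-⊒-∷⁻ : ∀ d A {k B} → drop d A ⊒ (k ∷ B) → drop (suc d) A ⊒ B
drop-⊒-∷⁻ zero    []      _       = []
drop-⊒-∷⁻ zero    (a ∷ A) (_ ∷ h) = h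
drop-⊒-∷⁻ (suc d) []      _       = []
drop-⊒-∷⁻ (suc d) (a ∷ A) h       = drop-⊒-∷⁻ d A h

∷-⋣ : ∀ {k A B} → All (k <_) B → ¬ (k ∷ A) ⊒ B
∷-⋣ (k<b ∷ _) (b≤k ∷ _) = <-irrefl refl (<-≤-trans k<b b≤k)

counts-+-suc : ∀ c d ws → counts (c + suc d) ws ≡ counts (suc c + d) ws
counts-+-suc c d ws = cong (λ x → counts x ws) (+-suc c d)

-- d is the number of vertical links that ws is ahead of us before index k.
counts≤⇒⊒ : ∀ k d c us ws → Pointwise _≤_ (counts c us) (counts (c + d) ws) →
            drop d (positions k us) ⊒ positions k ws
counts≤⇒⊒ k d       c []           []           [] = subst (_⊒ []) (sym (drop-[] d)) []
counts≤⇒⊒ k d       c (false ∷ us) (false ∷ ws) (_ ∷ pw) = counts≤⇒⊒ (suc k) d c us ws pw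
counts≤⇒⊒ k zero    c (true  ∷ us) (true  ∷ ws) (_ ∷ pw) = ≤-refl ∷ counts≤⇒⊒ (suc k) zero (suc c) us ws pw
counts≤⇒⊒ k (suc d) c (true  ∷ us) (true  ∷ ws) (_ ∷ pw) =
  drop-⊒-∷ d _ (positions-≥ (suc k) us) (counts≤⇒⊒ (suc k) (suc d) (suc c) us ws pw)
counts≤⇒⊒ k d       c (false ∷ us) (true  ∷ ws) (_ ∷ pw) =
  drop-⊒-∷ d _ (positions-≥ (suc k) us)
    (counts≤⇒⊒ (suc k) (suc d) c us ws (subst (Pointwise _≤_ _) (sym (counts-+-suc c d ws)) pw))
counts≤⇒⊒ k zero    c (true  ∷ us) (false ∷ ws) (c<c ∷ _) = ⊥-elim (n≮n c (subst (c <_) (+-identityʳ c) c<c))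
counts≤⇒⊒ k (suc d) c (true  ∷ us) (false ∷ ws) (_ ∷ pw) =
  counts≤⇒⊒ (suc k) d (suc c) us ws (subst (Pointwise _≤_ _) (counts-+-suc c d ws) pw)

⊒⇒counts≤ : ∀ k d c us ws → length us ≡ length ws → drop d (positions k us) ⊒ positions k ws →
            Pointwise _≤_ (counts c us) (counts (c + d) ws)
⊒⇒counts≤ k d       c []           []           _ _ = []
⊒⇒counts≤ k d       c (false ∷ us) (false ∷ ws) e h =
  m≤m+n c d ∷ ⊒⇒counts≤ (suc k) d c us ws (suc-injective e) h
⊒⇒counts≤ k zero    c (true  ∷ us) (true  ∷ ws) e (_ ∷ h) =
  s≤s (m≤m+n c 0) ∷ ⊒⇒counts≤ (suc k) zero (suc c) us ws (suc-injective e) h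
⊒⇒counts≤ k (suc d) c (true  ∷ us) (true  ∷ ws) e h =
  s≤s (m≤m+n c (suc d)) ∷ ⊒⇒counts≤ (suc k) (suc d) (suc c) us ws (suc-injective e) (drop-⊒-∷⁻ d _ h)
⊒⇒counts≤ k d       c (false ∷ us) (true  ∷ ws) e h =
  m≤n⇒m≤1+n (m≤m+n c d) ∷
  subst (Pointwise _≤_ _) (counts-+-suc c d ws)
    (⊒⇒counts≤ (suc k) (suc d) c us ws (suc-injective e) (drop-⊒-∷⁻ d _ h))
⊒⇒counts≤ k zero    c (true  ∷ us) (false ∷ ws) _ h = ⊥-elim (∷-⋣ (positions-≥ (suc k) ws) h)
⊒⇒counts≤ k (suc d) c (true  ∷ us) (false ∷ ws) e h =
  subst (suc c ≤_) (sym (+-suc c d)) (s≤s (m≤m+n c d)) ∷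
  subst (Pointwise _≤_ _) (sym (counts-+-suc c d ws)) (⊒⇒counts≤ (suc k) d (suc c) us ws (suc-injective e) h)

module _ (n : ℕ) where

  length-verticals : ∀ (p : State n) → length (verticals (cfg p)) ≡ n
  length-verticals (ds , len , _) = trans (length-map vertical ds) len

  toSubset : State n → SpreadOut n
  toSubset (ds , len , v) =
    positions 1 (verticals ds) , positions-spreadFrom n 1 (valid⇒arm {ds} v) (cong suc len)

  toState : SpreadOut n → State n
  toState (A , sp) =
    orient false (indicator 1 n A) ,
    trans (length-orient false (indicator 1 n A)) (length-indicator 1 n A) ,
    arm⇒valid (orient-indicator-arm false false 1 n A sp)

  toState-toSubset : ∀ p → cfg (toState (toSubset p)) ≡ cfg p
  toState-toSubset p@(ds , _ , v) = begin
    orient false (indicator 1 n (positions 1 (verticals ds)))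
      ≡⟨ cong (λ r → orient false (indicator 1 r (positions 1 (verticals ds)))) (sym (length-verticals p)) ⟩
    orient false (indicator 1 (length (verticals ds)) (positions 1 (verticals ds)))
      ≡⟨ cong (orient false) (indicator-positions 1 (verticals ds)) ⟩
    orient false (verticals ds)
      ≡⟨ orient-verticals (valid⇒arm {ds} v) ⟩
    ds ∎
    where open ≡-Reasoning

  toSubset-toState : ∀ A → elems (toSubset (toState A)) ≡ elems A
  toSubset-toState (A , sp) = begin
    positions 1 (verticals (orient false (indicator 1 n A))) ≡⟨ cong (positions 1) (verticals-orient false (indicator 1 n A)) ⟩
    positions 1 (indicator 1 n A)                           ≡⟨ positions-indicator n 1 n A refl sp ⟩
    A ∎
    where open ≡-Reasoning

  _≼_ : State n → State n → Set
  p ≼ q = Pointwise _≤_ (profile (cfg p)) (profile (cfg q))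

  length-profile-state : ∀ (p : State n) → length (profile (cfg p)) ≡ n
  length-profile-state p = trans (length-counts 0 (verticals (cfg p))) (length-verticals p)

  profile-home-state : ∀ (q : State n) → profile (home n) ≡ replicate (length (profile (cfg q))) 0
  profile-home-state q = trans (profile-home n) (cong (λ m → replicate m 0) (sym (length-profile-state q)))

  arm : ∀ (p : State n) → Arm false false (cfg p)
  arm (ds , _ , v) = valid⇒arm {ds} v

  walk-from-home : ∀ (q : State n) → Walk (home n) (cfg q) (sum (profile (cfg q)))
  walk-from-home q = walk-up _ (home-arm n) (arm q) home≤q (cong (_+ _) (sum-profile-home n))
    where
    home≤q : Pointwise _≤_ (profile (home n)) (profile (cfg q))
    home≤q = subst (λ xs → Pointwise _≤_ xs (profile (cfg q))) (sym (profile-home-state q)) (zeros-≤ _)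

  walk-from-home-length : ∀ (q : State n) {l} → Walk (home n) (cfg q) l → sum (profile (cfg q)) ≤ l
  walk-from-home-length q wk = subst (_≤ _) home-dist (walk-length wk)
    where
    home-dist : dist (profile (home n)) (profile (cfg q)) ≡ sum (profile (cfg q))
    home-dist = trans (cong (λ xs → dist xs (profile (cfg q))) (profile-home-state q)) (dist-zeros (profile (cfg q)))

  ≤ₛ⇒≼ : ∀ p q → p ≤ₛ q → p ≼ q
  ≤ₛ⇒≼ p q (k , m , home→p , p→q , shortest) =
    geodesic⇒≤ (profile (cfg p)) (profile (cfg q))
      (trans (length-profile-state p) (sym (length-profile-state q)))
      (≤-trans (+-mono-≤ (walk-from-home-length p home→p) (walk-length p→q)) (shortest _ (walk-from-home q)))

  ≼⇒≤ₛ : ∀ p q → p ≼ q → p ≤ₛ q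
  ≼⇒≤ₛ p q p≼q =
    sum (profile (cfg p)) , sum (profile (cfg q)) ∸ sum (profile (cfg p)) ,
    walk-from-home p , walk-up _ (arm p) (arm q) p≼q total ,
    λ l wk → subst (_≤ l) (sym total) (walk-from-home-length q wk)
    where
    total : sum (profile (cfg p)) + (sum (profile (cfg q)) ∸ sum (profile (cfg p))) ≡ sum (profile (cfg q))
    total = m+[n∸m]≡n (sum-mono p≼q)

  length-toSubset : ∀ p → length (elems (toSubset p)) ≤ n
  length-toSubset p = ≤-trans (length-positions 1 (verticals (cfg p))) (≤-reflexive (length-verticals p))

  ≼⇒≤w : ∀ p q → p ≼ q → toSubset p ≤w toSubset q
  ≼⇒≤w p q p≼q =
    ⊒⇒padded-≥ (suc n) n _ _ (counts≤⇒⊒ 1 0 0 _ _ p≼q)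
      (spreadFrom-< (proj₂ (toSubset q))) (length-toSubset p) (length-toSubset q)

  ≤w⇒≼ : ∀ p q → toSubset p ≤w toSubset q → p ≼ q
  ≤w⇒≼ p q p≤q =
    ⊒⇒counts≤ 1 0 0 _ _ (trans (length-verticals p) (sym (length-verticals q)))
      (padded-≥⇒⊒ (suc n) n _ _ p≤q (spreadFrom-< (proj₂ (toSubset p))) (length-toSubset p))

proposition5p4 : (n : ℕ) → 1 ≤ n →
    Σ (State n → SpreadOut n) λ f →
    Σ (SpreadOut n → State n) λ g →
      (∀ p → cfg (g (f p)) ≡ cfg p) ×
      (∀ A → elems (f (g A)) ≡ elems A) ×
      (∀ p q → (p ≤ₛ q → f p ≤w f q) × (f p ≤w f q → p ≤ₛ q))
proposition5p4 n _ =
  toSubset n , toState n , toState-toSubset n , toSubset-toState n ,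
  λ p q → ≼⇒≤w n p q ∘ ≤ₛ⇒≼ n p q , ≼⇒≤ₛ n p q ∘ ≤w⇒≼ n p q
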